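{- Let $P,Q$ be finite sets of propositional variables, $M=(W,\prec,\Vdash)$ and $M'=(W',\prec',\Vdash')$ Kripke models, $w\in W$, $w'\in W'$ and $n\in\omega$. The following are equivalent: (1) $\mathrm{Th}_n^{(P,Q)}(w)\subseteq\mathrm{Th}_n^{(P,Q)}(w')$; (2) there exists a layered $(P,Q)$-bisimulation $Z$ between $M$ and $M'$ with $(w,n,w')\in Z$; (3) there exists a downward closed layered $(P,Q)$-bisimulation $Z$ between $M$ and $M'$ with $(w,n,w')\in Z$.
   Context: Formulas are built from propositional variables, $\bot$, $\to$, $\Box$. Modal depth: $d(p)=d(\bot)=0$, $d(\varphi\to\psi)=\max\{d(\varphi),d(\psi)\}$, $d(\Box\varphi)=d(\varphi)+1$. Positive/negative variable sets: $v^+(p)=\{p\}$, $v^-(p)=\emptyset$; $v^\pm(\bot)=\emptyset$; $v^+(\psi\to\theta)=v^-(\psi)\cup v^+(\theta)$, $v^-(\psi\to\theta)=v^+(\psi)\cup v^-(\theta)$; $v^\pm(\Box\psi)=v^\pm(\psi)$. A $(P,Q)$-formula is a formula $\varphi$ with $v^+(\varphi)\subseteq P$, $v^-(\varphi)\subseteq Q$. For each $n$, $F_n^{(P,Q)}$ is a fixed finite set of $(P,Q)$-formulas of depth $\le n$ such that every $(P,Q)$-formula of depth $\le n$ is $\mathbf{K}$-provably equivalent to a member of it. A Kripke model $(W,\prec,\Vdash)$: $W$ nonempty, $\prec$ a binary relation on $W$, $\Vdash$ satisfaction with usual Boolean clauses and $x\Vdash\Box\varphi$ iff $y\Vdash\varphi$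 for all $y\succ x$. $\mathrm{Th}_n^{(P,Q)}(w)=\{\varphi\in F_n^{(P,Q)}: w\Vdash\varphi\}$. A relation $Z\subseteq W\times\omega\times W'$ is a layered $(P,Q)$-bisimulation between $M$ and $M'$ if: (i) whenever $(w,n,w')\in Z$: for each $p\in P$, $w\Vdash p$ implies $w'\Vdash' p$, and for each $q\in Q$, $w\nVdash q$ implies $w'\nVdash' q$; (ii) if $(w,n+1,w')\in Z$ and $w\prec x$, there is $x'\in W'$ with $w'\prec' x'$ and $(x,n,x')\in Z$; (iii) if $(w,n+1,w')\in Z$ and $w'\prec' x'$, there is $x\in W$ with $w\prec x$ and $(x,n,x')\in Z$. $Z$ is downward closed if $(w,n,w')\in Z$ implies $(w,m,w')\in Z$ for all $m\le n$. -}

module Defs where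

open import Data.Nat using (ℕ; zero; suc; _≤_; _⊔_)
open import Data.List using (List; []; [_]; _++_)
open import Data.List.Membership.Propositional using (_∈_)
open import Data.List.Relation.Binary.Subset.Propositional using (_⊆_)
open import Data.Product using (_×_; ∃; _,_)
open import Data.Empty using (⊥)
open import Relation.Nullary using (¬_)

Var : Set
Var = ℕ

infixr 5 _⇒_
data Fm : Set where
  var : Var → Fm
  ⊥'  : Fm
  _⇒_ : Fm → Fm → Fm
  □_  : Fm → Fm

depth : Fm → ℕ
depth (var p) = 0
depth ⊥' = 0
depth (φ ⇒ ψ) = depth φ ⊔ depth ψ
depth (□ φ) = suc (depth φ)

mutual
  v⁺ : Fm → List Var
  v⁺ (var p) = [ p ]
  v⁺ ⊥' = []
  v⁺ (ψ ⇒ θ) = v⁻ ψ ++ v⁺ θ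
  v⁺ (□ ψ) = v⁺ ψ

  v⁻ : Fm → List Var
  v⁻ (var p) = []
  v⁻ ⊥' = []
  v⁻ (ψ ⇒ θ) = v⁺ ψ ++ v⁻ θ
  v⁻ (□ ψ) = v⁻ ψ

IsPQ : List Var → List Var → Fm → Set
IsPQ P Q φ = (v⁺ φ ⊆ P) × (v⁻ φ ⊆ Q)

data ⊢K : Fm → Set where
  ax1  : ∀ φ ψ → ⊢K (φ ⇒ (ψ ⇒ φ))
  ax2  : ∀ φ ψ χ → ⊢K ((φ ⇒ (ψ ⇒ χ)) ⇒ ((φ ⇒ ψ) ⇒ (φ ⇒ χ)))
  ax3  : ∀ φ → ⊢K (((φ ⇒ ⊥') ⇒ ⊥') ⇒ φ)
  axK  : ∀ φ ψ → ⊢K (□ (φ ⇒ ψ) ⇒ (□ φ ⇒ □ ψ))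
  mp   : ∀ {φ ψ} → ⊢K (φ ⇒ ψ) → ⊢K φ → ⊢K ψ
  nec  : ∀ {φ} → ⊢K φ → ⊢K (□ φ)

_≡K_ : Fm → Fm → Set
φ ≡K ψ = ⊢K (φ ⇒ ψ) × ⊢K (ψ ⇒ φ)

-- F is a valid choice of the sets F_n^{(P,Q)}:
-- each F n is a finite set (list) of (P,Q)-formulas of depth ≤ n, and every
-- (P,Q)-formula of depth ≤ n is K-provably equivalent to a member of F n.
IsNormalFormFamily : List Var → List Var → (ℕ → List Fm) → Set
IsNormalFormFamily P Q F =
  (∀ n φ → φ ∈ F n → IsPQ P Q φ × depth φ ≤ n)
  × (∀ n φ → IsPQ P Q φ → depth φ ≤ n → ∃ λ ψ → ψ ∈ F n × (φ ≡K ψ))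

record Model : Set₁ where
  field
    W   : Set
    _≺_ : W → W → Set
    V   : W → Var → Set

open Model public

_,_⊩_ : (M : Model) → W M → Fm → Set
M , x ⊩ var p = V M x p
M , x ⊩ ⊥' = ⊥
M , x ⊩ (φ ⇒ ψ) = M , x ⊩ φ → M , x ⊩ ψ
M , x ⊩ (□ φ) = ∀ y → _≺_ M x y → M , y ⊩ φ

ThIncl : (F : ℕ → List Fm) (n : ℕ) (M M' : Model) → W M → W M' → Set
ThIncl F n M M' w w' = ∀ φ → φ ∈ F n → M , w ⊩ φ → M' , w' ⊩ φ

IsLayeredBisim : List Var → List Var → (M M' : Model) → (W M → ℕ → W M' → Set) → Set
IsLayeredBisim P Q M M' Z =
  (∀ w n w' → Z w n w' →
      (∀ p → p ∈ P → V M w p → V M' w' p)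
    × (∀ q → q ∈ Q → ¬ V M w q → ¬ V M' w' q))
  × (∀ w n w' x → Z w (suc n) w' → _≺_ M w x →
       ∃ λ x' → _≺_ M' w' x' × Z x n x')
  × (∀ w n w' x' → Z w (suc n) w' → _≺_ M' w' x' →
       ∃ λ x → _≺_ M w x × Z x n x')

DownwardClosed : (M M' : Model) → (W M → ℕ → W M' → Set) → Set
DownwardClosed M M' Z = ∀ w n w' m → Z w n w' → m ≤ n → Z w m w'

-- A layered bisimulation carries every (P,Q)-formula of depth ≤ n forward along a triple at
-- level n, by induction on the formula: an implication reverses polarity, which is matched by
-- reading the bisimulation backwards as a (Q,P)-bisimulation; a box consumes one layer.
-- Conversely, the relation "every (P,Q)-formula of depth ≤ n true at x is true at x'" is a
-- downward closed layered bisimulation. For the forth condition, a successor y of x is matched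
-- by a successor of x' satisfying the finite conjunction of the members of F n true at y: the
-- diamond of that conjunction is a (P,Q)-formula of depth ≤ n + 1 true at x. The back condition
-- is the forth condition for the converse relation, which classically is the (Q,P)-transfer
-- relation, with the negated formulas of F as normal forms.
module Submission where

open import Defs
open import Axiom.ExcludedMiddle using (ExcludedMiddle)
open import Data.List using (List; []; _∷_; _++_; map; filter)
open import Data.List.Membership.Propositional using (_∈_)
open import Data.List.Membership.Propositional.Properties using (∈-++⁻; ∈-map⁺; ∈-map⁻; ∈-filter⁺; ∈-filter⁻)
open import Data.List.Relation.Binary.Subset.Propositional using (_⊆_)
open import Data.List.Relation.Binary.Subset.Propositional.Properties using (⊆-trans; xs⊆xs++ys; xs⊆ys++xs)
open import Data.List.Relation.Unary.Any using (here; there)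
open import Data.Nat using (ℕ; zero; suc; _≤_; z≤n; s≤s)
open import Data.Nat.Properties using (⊔-lub; m⊔n≤o⇒m≤o; m⊔n≤o⇒n≤o; ≤-trans)
open import Data.Product using (Σ; ∃; _×_; _,_; proj₁; proj₂)
open import Data.Sum using ([_,_])
open import Function using (_∘_; case_of_)
open import Function.Bundles using (_⇔_; mk⇔; module Equivalence)
open import Level using (0ℓ)
open import Relation.Binary.PropositionalEquality using (refl)
open import Relation.Nullary using (¬_; Dec)
open import Relation.Nullary.Decidable using (decidable-stable)

open Equivalence using (to; from)

variable
  P Q : List Var
  m n : ℕ
  φ ψ θ : Fm
  L : List Fm
  F : ℕ → List Fm
  M M' : Model

infix 25 ¬'_ ◇_

¬'_ : Fm → Fm
¬' φ = φ ⇒ ⊥'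

◇_ : Fm → Fm
◇ φ = ¬' (□ ¬' φ)

conj : List Fm → Fm
conj [] = ¬' ⊥'
conj (φ ∷ L) = ¬' (φ ⇒ ¬' conj L)

++-lub : {A B C : List Var} → A ⊆ C → B ⊆ C → A ++ B ⊆ C
++-lub {A} A⊆C B⊆C = [ A⊆C , B⊆C ] ∘ ∈-++⁻ A

record Bounded (P Q : List Var) (n : ℕ) (φ : Fm) : Set where
  constructor bounded
  field
    v⁺⊆ : v⁺ φ ⊆ P
    v⁻⊆ : v⁻ φ ⊆ Q
    depth≤ : depth φ ≤ n

Bounded-var : {p : Var} → p ∈ P → Bounded P Q n (var p)
Bounded-var p∈P = bounded (λ { (here refl) → p∈P }) (λ ()) z≤n

Bounded-var⁻ : {p : Var} → Bounded P Q n (var p) → p ∈ P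
Bounded-var⁻ (bounded p⁺ _ _) = p⁺ (here refl)

Bounded-⊥ : Bounded P Q n ⊥'
Bounded-⊥ = bounded (λ ()) (λ ()) z≤n

Bounded-⇒ : Bounded Q P n ψ → Bounded P Q n θ → Bounded P Q n (ψ ⇒ θ)
Bounded-⇒ (bounded ψ⁺ ψ⁻ dψ) (bounded θ⁺ θ⁻ dθ) = bounded (++-lub ψ⁻ θ⁺) (++-lub ψ⁺ θ⁻) (⊔-lub dψ dθ)

Bounded-⇒⁻ˡ : Bounded P Q n (ψ ⇒ θ) → Bounded Q P n ψ
Bounded-⇒⁻ˡ {ψ = ψ} {θ = θ} (bounded ⁺ ⁻ d) =
  bounded (⊆-trans (xs⊆xs++ys (v⁺ ψ) (v⁻ θ)) ⁻) (⊆-trans (xs⊆xs++ys (v⁻ ψ) (v⁺ θ)) ⁺) (m⊔n≤o⇒m≤o (depth ψ) (depth θ) d)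

Bounded-⇒⁻ʳ : Bounded P Q n (ψ ⇒ θ) → Bounded P Q n θ
Bounded-⇒⁻ʳ {ψ = ψ} {θ = θ} (bounded ⁺ ⁻ d) =
  bounded (⊆-trans (xs⊆ys++xs (v⁺ θ) (v⁻ ψ)) ⁺) (⊆-trans (xs⊆ys++xs (v⁻ θ) (v⁺ ψ)) ⁻) (m⊔n≤o⇒n≤o (depth ψ) (depth θ) d)

Bounded-□ : Bounded P Q n φ → Bounded P Q (suc n) (□ φ)
Bounded-□ (bounded ⁺ ⁻ d) = bounded ⁺ ⁻ (s≤s d)

Bounded-□⁻ : Bounded P Q (suc n) (□ φ) → Bounded P Q n φ
Bounded-□⁻ (bounded ⁺ ⁻ (s≤s d)) = bounded ⁺ ⁻ d

Bounded-¬ : Bounded P Q n φ → Bounded Q P n (¬' φ)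
Bounded-¬ b = Bounded-⇒ b Bounded-⊥

Bounded-◇ : Bounded P Q n φ → Bounded P Q (suc n) (◇ φ)
Bounded-◇ = Bounded-¬ ∘ Bounded-□ ∘ Bounded-¬

Bounded-conj : (∀ {φ} → φ ∈ L → Bounded P Q n φ) → Bounded P Q n (conj L)
Bounded-conj {L = []} _ = Bounded-¬ Bounded-⊥
Bounded-conj {L = φ ∷ L} b = Bounded-¬ (Bounded-⇒ (b (here refl)) (Bounded-¬ (Bounded-conj (b ∘ there))))

Bounded-weaken : m ≤ n → Bounded P Q m φ → Bounded P Q n φ
Bounded-weaken m≤n (bounded ⁺ ⁻ d) = bounded ⁺ ⁻ (≤-trans d m≤n)

Equivalent : Fm → Fm → Set₁
Equivalent φ ψ = ∀ M x → (M , x ⊩ φ) ⇔ (M , x ⊩ ψ)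

-- IsNormalFormFamily with K-provable equivalence weakened to semantic equivalence; in this
-- form it survives negating every formula (NormalForms-¬).
record NormalForms (P Q : List Var) (F : ℕ → List Fm) : Set₁ where
  field
    member-bounded : ∀ {n φ} → φ ∈ F n → Bounded P Q n φ
    normalise      : ∀ {n φ} → Bounded P Q n φ → ∃ λ ψ → ψ ∈ F n × Equivalent φ ψ

open NormalForms

Transfers : List Var → List Var → (M M' : Model) → W M → ℕ → W M' → Set
Transfers P Q M M' x n x' = ∀ φ → Bounded P Q n φ → M , x ⊩ φ → M' , x' ⊩ φ

ThIncl⇒Transfers : NormalForms P Q F → {x : W M} {x' : W M'} →
  ThIncl F n M M' x x' → Transfers P Q M M' x n x'
ThIncl⇒Transfers {M = M} {M' = M'} nf {x} {x'} T φ b xφ =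
  let (ψ , ψ∈F , φ≅ψ) = normalise nf b in from (φ≅ψ M' x') (T ψ ψ∈F (to (φ≅ψ M x) xφ))

Transfers⇒ThIncl : NormalForms P Q F → {x : W M} {x' : W M'} →
  Transfers P Q M M' x n x' → ThIncl F n M M' x x'
Transfers⇒ThIncl nf T φ φ∈F = T φ (member-bounded nf φ∈F)

Transfers-downwardClosed : DownwardClosed M M' (Transfers P Q M M')
Transfers-downwardClosed x n x' m T m≤n φ b = T φ (Bounded-weaken m≤n b)

⊩-◇⁺ : {x y : W M} → _≺_ M x y → M , y ⊩ φ → M , x ⊩ ◇ φ
⊩-◇⁺ x≺y yφ □¬φ = □¬φ _ x≺y yφ

⊩-conj⁺ : {x : W M} → (∀ {φ} → φ ∈ L → M , x ⊩ φ) → M , x ⊩ conj L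
⊩-conj⁺ {L = []} _ = λ ()
⊩-conj⁺ {L = φ ∷ L} h = λ f → f (h (here refl)) (⊩-conj⁺ (h ∘ there))

module Classical (em : ExcludedMiddle 0ℓ) where

  dne : {A : Set} → ¬ ¬ A → A
  dne = decidable-stable em

  ⊢K-sound : ⊢K φ → ∀ M x → M , x ⊩ φ
  ⊢K-sound (ax1 φ ψ) M x = λ a _ → a
  ⊢K-sound (ax2 φ ψ χ) M x = λ f g a → f a (g a)
  ⊢K-sound (ax3 φ) M x = dne
  ⊢K-sound (axK φ ψ) M x = λ f g y r → f y r (g y r)
  ⊢K-sound (mp d e) M x = ⊢K-sound d M x (⊢K-sound e M x)
  ⊢K-sound (nec d) M x = λ y _ → ⊢K-sound d M y

  ≡K⇒Equivalent : φ ≡K ψ → Equivalent φ ψ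
  ≡K⇒Equivalent (φ⇒ψ , ψ⇒φ) M x = mk⇔ (⊢K-sound φ⇒ψ M x) (⊢K-sound ψ⇒φ M x)

  ¬-Equivalent : Equivalent (¬' φ) ψ → Equivalent φ (¬' ψ)
  ¬-Equivalent ¬φ≅ψ M x = mk⇔ (λ xφ xψ → from (¬φ≅ψ M x) xψ xφ) (λ ¬ψ → dne λ ¬φ → ¬ψ (to (¬φ≅ψ M x) ¬φ))

  IsNormalFormFamily⇒NormalForms : IsNormalFormFamily P Q F → NormalForms P Q F
  IsNormalFormFamily⇒NormalForms (bnd , nrm) = record
    { member-bounded = λ φ∈F → let ((⁺ , ⁻) , d) = bnd _ _ φ∈F in bounded ⁺ ⁻ d
    ; normalise      = λ {n} {φ} (bounded ⁺ ⁻ d) → let (ψ , ψ∈F , φ≡ψ) = nrm n φ (⁺ , ⁻) d in ψ , ψ∈F , ≡K⇒Equivalent φ≡ψ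
    }

  NormalForms-¬ : NormalForms P Q F → NormalForms Q P (map ¬'_ ∘ F)
  NormalForms-¬ nf = record
    { member-bounded = λ φ∈¬F → case ∈-map⁻ ¬'_ φ∈¬F of λ { (ψ , ψ∈F , refl) → Bounded-¬ (member-bounded nf ψ∈F) }
    ; normalise      = λ {φ = φ} b → let (ψ , ψ∈F , ¬φ≅ψ) = normalise nf (Bounded-¬ b)
                                    in ¬' ψ , ∈-map⁺ ¬'_ ψ∈F , ¬-Equivalent {φ = φ} {ψ = ψ} ¬φ≅ψ
    }

  ⊩-◇⁻ : {x : W M} → M , x ⊩ ◇ φ → ∃ λ y → _≺_ M x y × M , y ⊩ φ
  ⊩-◇⁻ ◇φ = dne λ none → ◇φ λ y x≺y yφ → none (y , x≺y , yφ)

  ⊩-conj⁻ : {x : W M} → M , x ⊩ conj L → φ ∈ L → M , x ⊩ φ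
  ⊩-conj⁻ c (here refl) = dne λ ¬φ → c λ φ _ → ¬φ φ
  ⊩-conj⁻ c (there φ∈L) = ⊩-conj⁻ (dne λ ¬c → c λ _ c → ¬c c) φ∈L

  Transfers-converse : {x : W M} {x' : W M'} → Transfers P Q M M' x n x' → Transfers Q P M' M x' n x
  Transfers-converse T φ b x'φ = dne λ ¬xφ → T (¬' φ) (Bounded-¬ b) ¬xφ x'φ

  Transfers-forth : NormalForms P Q F → {x y : W M} {x' : W M'} →
    Transfers P Q M M' x (suc n) x' → _≺_ M x y → ∃ λ y' → _≺_ M' x' y' × Transfers P Q M M' y n y'
  Transfers-forth {F = F} {M = M} {n = n} nf {y = y} T x≺y =
    let (y' , x'≺y' , y'⊩Th-y) = ⊩-◇⁻ {φ = conj Th-y} (T (◇ conj Th-y) (Bounded-◇ (Bounded-conj (member-bounded nf ∘ proj₁ ∘ true-at-y)))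
                                      (⊩-◇⁺ {φ = conj Th-y} x≺y (⊩-conj⁺ (proj₂ ∘ true-at-y))))
    in y' , x'≺y' , λ φ b yφ →
         let (ψ , ψ∈F , φ≅ψ) = normalise nf b
         in from (φ≅ψ _ y') (⊩-conj⁻ y'⊩Th-y (∈-filter⁺ holds? ψ∈F (to (φ≅ψ M y) yφ)))
    where
    holds? : ∀ ψ → Dec (M , y ⊩ ψ)
    holds? ψ = em
    Th-y : List Fm
    Th-y = filter holds? (F n)
    true-at-y : ∀ {ψ} → ψ ∈ Th-y → ψ ∈ F n × M , y ⊩ ψ
    true-at-y = ∈-filter⁻ holds?

  Transfers-back : NormalForms P Q F → {x : W M} {x' y' : W M'} →
    Transfers P Q M M' x (suc n) x' → _≺_ M' x' y' → ∃ λ y → _≺_ M x y × Transfers P Q M M' y n y'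
  Transfers-back nf T x'≺y' =
    let (y , x≺y , T⁻¹) = Transfers-forth (NormalForms-¬ nf) (Transfers-converse T) x'≺y'
    in y , x≺y , Transfers-converse T⁻¹

  Transfers-isLayeredBisim : NormalForms P Q F → IsLayeredBisim P Q M M' (Transfers P Q M M')
  Transfers-isLayeredBisim nf =
      (λ x n x' T → (λ p p∈P → T (var p) (Bounded-var p∈P)) , (λ q q∈Q → T (¬' var q) (Bounded-¬ (Bounded-var q∈Q))))
    , (λ x n x' y T → Transfers-forth nf T)
    , (λ x n x' y' T → Transfers-back nf T)

  LayeredBisim-converse : {Z : W M → ℕ → W M' → Set} →
    IsLayeredBisim P Q M M' Z → IsLayeredBisim Q P M' M (λ x' n x → Z x n x')
  LayeredBisim-converse (atoms , forth , back) =
      (λ x' n x z → (λ q q∈Q x'q → dne λ ¬xq → let (_ , neg) = atoms x n x' z in neg q q∈Q ¬xq x'q)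
                  , (λ p p∈P ¬x'p xp → let (pos , _) = atoms x n x' z in ¬x'p (pos p p∈P xp)))
    , (λ x' n x y' z → back x n x' y' z)
    , (λ x' n x y z → forth x n x' y z)

  LayeredBisim⇒Transfers : {Z : W M → ℕ → W M' → Set} → IsLayeredBisim P Q M M' Z →
    ∀ {x n x'} → Z x n x' → Transfers P Q M M' x n x'
  LayeredBisim⇒Transfers (atoms , _) {x} {n} {x'} z (var p) b xp =
    let (pos , _) = atoms x n x' z in pos p (Bounded-var⁻ b) xp
  LayeredBisim⇒Transfers B z ⊥' b ()
  LayeredBisim⇒Transfers B z (ψ ⇒ θ) b xψ⇒θ x'ψ =
    LayeredBisim⇒Transfers B z θ (Bounded-⇒⁻ʳ b)
      (xψ⇒θ (LayeredBisim⇒Transfers (LayeredBisim-converse B) z ψ (Bounded-⇒⁻ˡ b) x'ψ))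
  LayeredBisim⇒Transfers B {n = zero} z (□ ψ) (bounded _ _ ()) x□ψ
  LayeredBisim⇒Transfers B@(_ , _ , back) {x} {suc n} {x'} z (□ ψ) b x□ψ y' x'≺y' =
    let (y , x≺y , z') = back x n x' y' z x'≺y'
    in LayeredBisim⇒Transfers B z' ψ (Bounded-□⁻ b) (x□ψ y x≺y)

theorem3p6 : ExcludedMiddle 0ℓ →
    (P Q : List Var) (F : ℕ → List Fm) → IsNormalFormFamily P Q F →
    (M M' : Model) (w : W M) (w' : W M') (n : ℕ) →
      (ThIncl F n M M' w w' ⇔ Σ (W M → ℕ → W M' → Set) (λ Z → IsLayeredBisim P Q M M' Z × Z w n w'))
    × (ThIncl F n M M' w w' ⇔ Σ (W M → ℕ → W M' → Set) (λ Z → IsLayeredBisim P Q M M' Z × DownwardClosed M M' Z × Z w n w'))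
theorem3p6 em P Q F isNF M M' w w' n =
    mk⇔ (λ T → Transfers P Q M M' , bisim , ThIncl⇒Transfers nf T)
        (λ (_ , B , z) → Transfers⇒ThIncl nf (LayeredBisim⇒Transfers B z))
  , mk⇔ (λ T → Transfers P Q M M' , bisim , Transfers-downwardClosed , ThIncl⇒Transfers nf T)
        (λ (_ , B , _ , z) → Transfers⇒ThIncl nf (LayeredBisim⇒Transfers B z))
  where
  open Classical em
  nf : NormalForms P Q F
  nf = IsNormalFormFamily⇒NormalForms isNF
  bisim : IsLayeredBisim P Q M M' (Transfers P Q M M')
  bisim = Transfers-isLayeredBisim nf
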